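{- Let $d\ge 3$ and let $(P,f,H)$ and $(Q,g,R)$ be two chambers of $\mathrm{PG}(d,q)$ whose coflags $f$ and $g$ are f-opposite. Then $R$ contains exactly one of the $q+1$ points on $f$.
   Context: In $\mathrm{PG}(d,q)$ a chamber is a tuple $(S_0,S_1,\dots,S_{d-1})$ of subspaces with $\dim S_i=i$ and $S_i\subseteq S_{i+1}$; it is also written $(P,f,H)$ with $P=S_0$ (a point), $f=(S_1,\dots,S_{d-2})$ (called a coflag) and $H=S_{d-1}$ (a hyperplane). Two coflags $f=(S_1,\dots,S_{d-2})$ and $g=(R_1,\dots,R_{d-2})$ are f-opposite if for all $S_i\in f$, $R_j\in g$ the subspaces $S_i$ and $R_j$ either have no common point or span the whole space. The points on $f$ are the points $P$ for which there is a hyperplane $H$ with $(P,f,H)$ a chamber, i.e. the points of the line $S_1$. -}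

module Defs where

open import Level using (Level; _⊔_)
open import Data.Nat using (ℕ; zero; suc; _≤_; _∸_)
open import Data.Fin using (Fin; toℕ)
import Data.Fin as Fin
open import Data.Product using (Σ; ∃; _×_; _,_)
open import Data.Sum using (_⊎_)
open import Relation.Nullary using (¬_; Dec)
open import Relation.Binary.PropositionalEquality using (_≡_)
open import Algebra.Bundles using (CommutativeRing)

-- A finite field with exactly q elements (equality is the setoid equality _≈_
-- of the commutative ring; it is required to be decidable, as it is in any
-- finite field).
record FiniteField (c ℓ : Level) (q : ℕ) : Set (Level.suc (c ⊔ ℓ)) where
  field
    commRing : CommutativeRing c ℓ
  open CommutativeRing commRing public
  field
    0≉1     : ¬ (0# ≈ 1#)
    _⁻¹     : (x : Carrier) → ¬ (x ≈ 0#) → Carrier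
    inverse : (x : Carrier) (nz : ¬ (x ≈ 0#)) → x * (x ⁻¹) nz ≈ 1#
    _≟_     : (x y : Carrier) → Dec (x ≈ y)
    enum      : Fin q → Carrier
    enum-inj  : ∀ i j → enum i ≈ enum j → i ≡ j
    enum-surj : ∀ x → ∃ λ i → x ≈ enum i

-- The projective geometry PG(d,q) over the field F, modelled on the
-- vector space F^(d+1).
module PG {c ℓ : Level} {q : ℕ} (F : FiniteField c ℓ q) (d : ℕ) where
  open FiniteField F

  Vector : Set c
  Vector = Fin (suc d) → Carrier

  _≈v_ : Vector → Vector → Set ℓ
  u ≈v v = ∀ k → u k ≈ v k

  0v : Vector
  0v _ = 0#

  _+v_ : Vector → Vector → Vector
  (u +v v) k = u k + v k

  _·v_ : Carrier → Vector → Vector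
  (a ·v v) k = a * v k

  sumv : ∀ {n} → (Fin n → Vector) → Vector
  sumv {zero}  vs = 0v
  sumv {suc n} vs = vs Fin.zero +v sumv (λ i → vs (Fin.suc i))

  lincomb : ∀ {n} → (Fin n → Carrier) → (Fin n → Vector) → Vector
  lincomb cs bs = sumv (λ i → cs i ·v bs i)

  -- A projective subspace of (projective) dimension `dim`, given as the span
  -- of dim+1 linearly independent vectors.
  record Subspace : Set (c ⊔ ℓ) where
    field
      dim   : ℕ
      basis : Fin (suc dim) → Vector
      indep : ∀ (cs : Fin (suc dim) → Carrier) →
              lincomb cs basis ≈v 0v → ∀ k → cs k ≈ 0#
  open Subspace public

  _∈_ : Vector → Subspace → Set (c ⊔ ℓ)
  v ∈ S = ∃ λ (cs : Fin (suc (dim S)) → Carrier) → v ≈v lincomb cs (basis S)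

  _⊆_ : Subspace → Subspace → Set (c ⊔ ℓ)
  S ⊆ T = ∀ v → v ∈ S → v ∈ T

  Nonzero : Vector → Set ℓ
  Nonzero v = ¬ (v ≈v 0v)

  -- a projective point P lies in S iff a (any) nonzero representative lies in S;
  -- projective points are nonzero vectors up to nonzero scalars.
  SamePoint : Vector → Vector → Set (c ⊔ ℓ)
  SamePoint u v = ∃ λ (a : Carrier) → u ≈v (a ·v v)

  NoCommonPoint : Subspace → Subspace → Set (c ⊔ ℓ)
  NoCommonPoint S T = ∀ v → v ∈ S → v ∈ T → v ≈v 0v

  SpanAll : Subspace → Subspace → Set (c ⊔ ℓ)
  SpanAll S T = ∀ (w : Vector) → ∃ λ u → ∃ λ v → u ∈ S × v ∈ T × w ≈v (u +v v)

  record Chamber : Set (c ⊔ ℓ) where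
    field
      sub     : Fin d → Subspace
      sub-dim : ∀ i → dim (sub i) ≡ toℕ i
      sub-inc : ∀ i j → suc (toℕ i) ≡ toℕ j → sub i ⊆ sub j
  open Chamber public

  InCoflag : Fin d → Set
  InCoflag i = 1 ≤ toℕ i × toℕ i ≤ d ∸ 2

  FOpposite : Chamber → Chamber → Set (c ⊔ ℓ)
  FOpposite C D = ∀ i j → InCoflag i → InCoflag j →
                  NoCommonPoint (sub C i) (sub D j) ⊎ SpanAll (sub C i) (sub D j)

-- Let L be the line S₁ of the first chamber, R the hyperplane of the second and
-- T ⊆ R its (d−2)-space S_{d−2}. By the dimension formula (ultimately: a homogeneous
-- linear system with more unknowns than equations has a nontrivial solution) the line L
-- meets R, and by Cramer's rule in the 2-dimensional vector space underlying L it
-- meets R in a single point unless L ⊆ R. But L ⊆ R is impossible since L and T are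
-- f-opposite: if they are disjoint, they still meet inside the (d−1)-space R because
-- 1 + (d−2) ≥ d−1; if they span the whole space, so does R.

{-# OPTIONS --safe #-}
module Submission where

open import Defs
open import Level using (Level; _⊔_)
open import Data.Nat as ℕ using (ℕ; zero; suc; _≤_; _<_; _∸_; s≤s; z≤n)
open import Data.Nat.Properties using (≤-refl; n≤1+n; +-suc; <⇒≱; ≮⇒≥)
open import Data.Fin using (Fin; toℕ; zero; suc; punchIn; punchOut; _↑ˡ_; _↑ʳ_; splitAt; fromℕ<)
open import Data.Fin.Properties using (any?; punchIn-punchOut; join-splitAt; toℕ-fromℕ<)
  renaming (_≟_ to _≟ᶠ_)
open import Data.Vec.Functional using (_∷_; _++_; take; drop)
open import Data.Vec.Functional.Properties using (lookup-++ˡ; lookup-++ʳ)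
open import Data.Vec.Functional.Relation.Unary.All.Properties using (++⁺)
open import Data.Product using (∃; _×_; _,_; proj₁; proj₂)
open import Data.Sum using (_⊎_; inj₁; inj₂)
open import Data.Sum.Properties using ([,]-∘)
open import Function using (_∘_)
open import Relation.Nullary using (¬_; yes; no)
open import Relation.Nullary.Negation using (contradiction)
open import Relation.Nullary.Decidable using (¬?; decidable-stable)
import Relation.Binary.PropositionalEquality as ≡
open ≡ using (_≡_; _≗_)

take-++-drop : ∀ {a} {A : Set a} m {n} (xs : Fin (m ℕ.+ n) → A) → take m xs ++ drop m xs ≗ xs
take-++-drop m xs k = ≡.trans (≡.sym ([,]-∘ xs (splitAt m k))) (≡.cong xs (join-splitAt m _ k))

module LinearAlgebra {c ℓ : Level} {q : ℕ} (F : FiniteField c ℓ q) where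
  open FiniteField F hiding (zero)
  open import Algebra.Properties.Semiring.Sum semiring public
    using (sum; sum-cong-≋; sum-cong-≗; sum-replicate-zero; ∑-distrib-+; *-distribˡ-sum; ∑-comm)
  open import Algebra.Properties.Ring ring using (-‿distribˡ-*; -‿distribʳ-*)
  open import Algebra.Properties.Group +-group using () renaming (x∙y⁻¹≈ε⇒x≈y to x-y≈0⇒x≈y)
  open import Algebra.Solver.Ring.NaturalCoefficients.Default commutativeSemiring public
    using (solve; _:+_; _:*_; _:=_; con)
  open import Relation.Binary.Reasoning.Setoid setoid

  NonTrivial : ∀ {m} → (Fin m → Carrier) → Set ℓ
  NonTrivial x = ∃ λ j → ¬ x j ≈ 0#

  zero-or-nonTrivial : ∀ {m} (x : Fin m → Carrier) → (∀ j → x j ≈ 0#) ⊎ NonTrivial x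
  zero-or-nonTrivial x with any? (λ j → ¬? (x j ≟ 0#))
  ... | yes nonTrivial = inj₂ nonTrivial
  ... | no  trivial    = inj₁ λ j → decidable-stable (x j ≟ 0#) (λ xj≉0 → trivial (j , xj≉0))

  1≉0 : ¬ 1# ≈ 0#
  1≉0 1≈0 = 0≉1 (sym 1≈0)

  ⁻¹-cancelʳ : ∀ {a} (a≉0 : ¬ a ≈ 0#) y → a * ((a ⁻¹) a≉0 * y) ≈ y
  ⁻¹-cancelʳ {a} a≉0 y = begin
    a * ((a ⁻¹) a≉0 * y) ≈⟨ sym (*-assoc _ _ _) ⟩
    (a * (a ⁻¹) a≉0) * y ≈⟨ *-congʳ (inverse a a≉0) ⟩
    1# * y               ≈⟨ *-identityˡ y ⟩
    y                    ∎

  ⁻¹-cancelˡ : ∀ {a} (a≉0 : ¬ a ≈ 0#) y → (a ⁻¹) a≉0 * (a * y) ≈ y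
  ⁻¹-cancelˡ {a} a≉0 y =
    trans (solve 3 (λ a⁻¹ a y → a⁻¹ :* (a :* y) := a :* (a⁻¹ :* y)) refl _ a y) (⁻¹-cancelʳ a≉0 y)

  -‿cancel : ∀ x y → x * y + (- x) * y ≈ 0#
  -‿cancel x y = begin
    x * y + (- x) * y ≈⟨ sym (distribʳ y x (- x)) ⟩
    (x - x) * y       ≈⟨ *-congʳ (-‿inverseʳ x) ⟩
    0# * y            ≈⟨ zeroˡ y ⟩
    0#                ∎

  δ : ∀ {n} → Fin n → Fin n → Carrier
  δ zero    zero    = 1#
  δ zero    (suc _) = 0#
  δ (suc _) zero    = 0#
  δ (suc i) (suc j) = δ i j

  ∑-δ : ∀ {n} (f : Fin n → Carrier) k → sum (λ i → f i * δ i k) ≈ f k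
  ∑-δ {suc n} f zero = begin
    f zero * 1# + sum (λ i → f (suc i) * 0#) ≈⟨ +-cong (*-identityʳ _) (sum-cong-≋ (λ i → zeroʳ (f (suc i)))) ⟩
    f zero + sum {n} (λ _ → 0#)              ≈⟨ +-congˡ (sum-replicate-zero n) ⟩
    f zero + 0#                              ≈⟨ +-identityʳ _ ⟩
    f zero                                   ∎
  ∑-δ {suc n} f (suc k) = begin
    f zero * 0# + sum (λ i → f (suc i) * δ i k) ≈⟨ +-cong (zeroʳ _) (∑-δ (f ∘ suc) k) ⟩
    0# + f (suc k)                              ≈⟨ +-identityˡ _ ⟩
    f (suc k)                                   ∎

  ∑-++ : ∀ a {b} (f : Fin (a ℕ.+ b) → Carrier) → sum f ≈ sum (take a f) + sum (drop a f)
  ∑-++ zero    f = sym (+-identityˡ _)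
  ∑-++ (suc a) f = trans (+-congˡ (∑-++ a (f ∘ suc))) (sym (+-assoc _ _ _))

  infix 8 _⋅_
  _⋅_ : ∀ {m} → (Fin m → Carrier) → (Fin m → Carrier) → Carrier
  u ⋅ x = sum (λ j → u j * x j)

  ⋅-linearˡ : ∀ {m} (u v y : Fin m → Carrier) a → (λ j → u j + a * v j) ⋅ y ≈ u ⋅ y + a * (v ⋅ y)
  ⋅-linearˡ u v y a = begin
    sum (λ j → (u j + a * v j) * y j)
      ≈⟨ sum-cong-≋ (λ j → solve 4 (λ u v y a → (u :+ a :* v) :* y := u :* y :+ a :* (v :* y)) refl (u j) (v j) (y j) a) ⟩
    sum (λ j → u j * y j + a * (v j * y j)) ≈⟨ ∑-distrib-+ (λ j → u j * y j) (λ j → a * (v j * y j)) ⟩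
    u ⋅ y + sum (λ j → a * (v j * y j))     ≈⟨ +-congˡ (sym (*-distribˡ-sum a (λ j → v j * y j))) ⟩
    u ⋅ y + a * (v ⋅ y)                     ∎

  Solves : ∀ {n m} → (Fin n → Fin m → Carrier) → (Fin m → Carrier) → Set ℓ
  Solves A x = ∀ i → A i ⋅ x ≈ 0#

  module Elimination {n m} (A : Fin (suc n) → Fin (suc m) → Carrier)
                     (p : Fin (suc n)) (pivot≉0 : ¬ A p zero ≈ 0#) where

    pivot⁻¹ : Carrier
    pivot⁻¹ = (A p zero ⁻¹) pivot≉0

    reduced : Fin n → Fin m → Carrier
    reduced i j = A (punchIn p i) (suc j) + (- (A (punchIn p i) zero * pivot⁻¹)) * A p (suc j)

    backSubstitute : (Fin m → Carrier) → Fin (suc m) → Carrier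
    backSubstitute y = (- (pivot⁻¹ * (A p ∘ suc) ⋅ y)) ∷ y

    backSubstitute-solves : ∀ y → Solves reduced y → Solves A (backSubstitute y)
    backSubstitute-solves y y-solves i with p ≟ᶠ i
    ... | yes ≡.refl = begin
      a * - (pivot⁻¹ * s) + s   ≈⟨ +-congʳ (sym (-‿distribʳ-* a _)) ⟩
      - (a * (pivot⁻¹ * s)) + s ≈⟨ +-congʳ (-‿cong (⁻¹-cancelʳ pivot≉0 s)) ⟩
      - s + s                   ≈⟨ -‿inverseˡ s ⟩
      0#                        ∎
      where
      a s : Carrier
      a = A p zero
      s = (A p ∘ suc) ⋅ y
    ... | no p≢i = ≡.subst (λ i → A i ⋅ backSubstitute y ≈ 0#) (punchIn-punchOut p≢i) (row (punchOut p≢i))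
      where
      row : ∀ i → A (punchIn p i) ⋅ backSubstitute y ≈ 0#
      row i = begin
        b * - (pivot⁻¹ * s) + t     ≈⟨ +-comm _ t ⟩
        t + b * - (pivot⁻¹ * s)     ≈⟨ +-congˡ (sym (-‿distribʳ-* b _)) ⟩
        t + - (b * (pivot⁻¹ * s))   ≈⟨ +-congˡ (-‿cong (sym (*-assoc b _ s))) ⟩
        t + - (b * pivot⁻¹ * s)     ≈⟨ +-congˡ (-‿distribˡ-* _ s) ⟩
        t + - (b * pivot⁻¹) * s     ≈⟨ sym (⋅-linearˡ (A (punchIn p i) ∘ suc) (A p ∘ suc) y _) ⟩
        reduced i ⋅ y               ≈⟨ y-solves i ⟩
        0#                          ∎
        where
        b s t : Carrier
        b = A (punchIn p i) zero
        s = (A p ∘ suc) ⋅ y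
        t = (A (punchIn p i) ∘ suc) ⋅ y

  homogeneous-nonTrivial : ∀ {n m} → n < m → (A : Fin n → Fin m → Carrier) →
                           ∃ λ x → NonTrivial x × Solves A x
  homogeneous-nonTrivial {zero} {suc m} _ A = (λ _ → 1#) , (zero , 1≉0) , λ ()
  homogeneous-nonTrivial {suc n} {suc m} (s≤s n<m) A with zero-or-nonTrivial (λ i → A i zero)
  ... | inj₁ first-column≈0 = (λ j → δ j zero) , (zero , 1≉0) , λ i → trans (∑-δ (A i) zero) (first-column≈0 i)
  ... | inj₂ (p , pivot≉0) =
    let open Elimination A p pivot≉0
        (y , (j , yj≉0) , y-solves) = homogeneous-nonTrivial n<m reduced
    in backSubstitute y , (suc j , yj≉0) , backSubstitute-solves y y-solves

  det : (Fin 2 → Carrier) → (Fin 2 → Carrier) → Carrier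
  det a b = a zero * b (suc zero) - a (suc zero) * b zero

  det≈0⇒proportional : ∀ {a b} → det a b ≈ 0# → ∀ p (aₚ≉0 : ¬ a p ≈ 0#) →
                       ∀ k → b k ≈ ((a p ⁻¹) aₚ≉0 * b p) * a k
  det≈0⇒proportional {a} {b} det≈0 p aₚ≉0 k = begin
    b k                ≈⟨ sym (⁻¹-cancelˡ aₚ≉0 (b k)) ⟩
    aₚ⁻¹ * (a p * b k) ≈⟨ *-congˡ (minors p k) ⟩
    aₚ⁻¹ * (a k * b p) ≈⟨ solve 3 (λ x y z → x :* (y :* z) := (x :* z) :* y) refl aₚ⁻¹ (a k) (b p) ⟩
    (aₚ⁻¹ * b p) * a k ∎
    where
    aₚ⁻¹ : Carrier
    aₚ⁻¹ = (a p ⁻¹) aₚ≉0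
    minors : ∀ i j → a i * b j ≈ a j * b i
    minors zero       zero       = refl
    minors zero       (suc zero) = x-y≈0⇒x≈y _ _ det≈0
    minors (suc zero) zero       = sym (x-y≈0⇒x≈y _ _ det≈0)
    minors (suc zero) (suc zero) = refl

module Subspaces {c ℓ : Level} {q : ℕ} (F : FiniteField c ℓ q) (d : ℕ) where
  open FiniteField F hiding (zero)
  open PG F d
  open LinearAlgebra F
  open import Algebra.Properties.Ring ring using (-1*x≈-x; -‿distribˡ-*)
  open import Algebra.Properties.Group +-group using (inverseˡ-unique)
  open import Relation.Binary.Reasoning.Setoid setoid

  InSpan : ∀ {n} → (Fin n → Vector) → Vector → Set (c ⊔ ℓ)
  InSpan B v = ∃ λ cs → v ≈v lincomb cs B

  Independent : ∀ {n} → (Fin n → Vector) → Set (c ⊔ ℓ)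
  Independent B = ∀ cs → lincomb cs B ≈v 0v → ∀ k → cs k ≈ 0#

  sumv-pointwise : ∀ {n} (vs : Fin n → Vector) k → sumv vs k ≈ sum (λ i → vs i k)
  sumv-pointwise {zero}  vs k = refl
  sumv-pointwise {suc n} vs k = +-congˡ (sumv-pointwise (vs ∘ suc) k)

  lincomb-pointwise : ∀ {n} (cs : Fin n → Carrier) (B : Fin n → Vector) k →
                      lincomb cs B k ≈ sum (λ i → cs i * B i k)
  lincomb-pointwise cs B = sumv-pointwise (λ i → cs i ·v B i)

  lincomb-cong : ∀ {n} {cs ds : Fin n → Carrier} (B : Fin n → Vector) → (∀ i → cs i ≈ ds i) →
                 lincomb cs B ≈v lincomb ds B
  lincomb-cong {cs = cs} {ds} B cs≈ds k = begin
    lincomb cs B k            ≈⟨ lincomb-pointwise cs B k ⟩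
    sum (λ i → cs i * B i k)  ≈⟨ sum-cong-≋ (λ i → *-congʳ (cs≈ds i)) ⟩
    sum (λ i → ds i * B i k)  ≈⟨ lincomb-pointwise ds B k ⟨
    lincomb ds B k            ∎

  lincomb-zero : ∀ {n} {cs : Fin n → Carrier} (B : Fin n → Vector) → (∀ i → cs i ≈ 0#) →
                 lincomb cs B ≈v 0v
  lincomb-zero {n} {cs} B cs≈0 k = begin
    lincomb cs B k            ≈⟨ lincomb-pointwise cs B k ⟩
    sum (λ i → cs i * B i k)  ≈⟨ sum-cong-≋ (λ i → trans (*-congʳ (cs≈0 i)) (zeroˡ (B i k))) ⟩
    sum {n} (λ _ → 0#)        ≈⟨ sum-replicate-zero n ⟩
    0#                        ∎

  lincomb-+ : ∀ {n} (cs ds : Fin n → Carrier) (B : Fin n → Vector) →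
              lincomb (λ i → cs i + ds i) B ≈v (lincomb cs B +v lincomb ds B)
  lincomb-+ cs ds B k = begin
    lincomb (λ i → cs i + ds i) B k                       ≈⟨ lincomb-pointwise _ B k ⟩
    sum (λ i → (cs i + ds i) * B i k)                     ≈⟨ sum-cong-≋ (λ i → distribʳ (B i k) (cs i) (ds i)) ⟩
    sum (λ i → cs i * B i k + ds i * B i k)               ≈⟨ ∑-distrib-+ (λ i → cs i * B i k) (λ i → ds i * B i k) ⟩
    sum (λ i → cs i * B i k) + sum (λ i → ds i * B i k)   ≈⟨ +-cong (lincomb-pointwise cs B k) (lincomb-pointwise ds B k) ⟨
    lincomb cs B k + lincomb ds B k                       ∎

  lincomb-· : ∀ {n} a (cs : Fin n → Carrier) (B : Fin n → Vector) →
              lincomb (λ i → a * cs i) B ≈v (a ·v lincomb cs B)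
  lincomb-· a cs B k = begin
    lincomb (λ i → a * cs i) B k        ≈⟨ lincomb-pointwise _ B k ⟩
    sum (λ i → a * cs i * B i k)        ≈⟨ sum-cong-≋ (λ i → *-assoc a (cs i) (B i k)) ⟩
    sum (λ i → a * (cs i * B i k))      ≈⟨ *-distribˡ-sum a (λ i → cs i * B i k) ⟨
    a * sum (λ i → cs i * B i k)        ≈⟨ *-congˡ (lincomb-pointwise cs B k) ⟨
    a * lincomb cs B k                  ∎

  lincomb-++ : ∀ {a b} (cs : Fin (a ℕ.+ b) → Carrier) (S : Fin a → Vector) (T : Fin b → Vector) →
               lincomb cs (S ++ T) ≈v (lincomb (take a cs) S +v lincomb (drop a cs) T)
  lincomb-++ {a} {b} cs S T k = begin
    lincomb cs (S ++ T) k
      ≈⟨ lincomb-pointwise cs (S ++ T) k ⟩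
    sum (λ i → cs i * (S ++ T) i k)
      ≈⟨ ∑-++ a (λ i → cs i * (S ++ T) i k) ⟩
    sum (λ i → cs (i ↑ˡ b) * (S ++ T) (i ↑ˡ b) k) + sum (λ j → cs (a ↑ʳ j) * (S ++ T) (a ↑ʳ j) k)
      ≡⟨ ≡.cong₂ _+_ (sum-cong-≗ (λ i → ≡.cong (λ x → cs (i ↑ˡ b) * x k) (lookup-++ˡ S T i)))
                     (sum-cong-≗ (λ j → ≡.cong (λ x → cs (a ↑ʳ j) * x k) (lookup-++ʳ S T j))) ⟩
    sum (λ i → cs (i ↑ˡ b) * S i k) + sum (λ j → cs (a ↑ʳ j) * T j k)
      ≈⟨ +-cong (lincomb-pointwise (take a cs) S k) (lincomb-pointwise (drop a cs) T k) ⟨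
    lincomb (take a cs) S k + lincomb (drop a cs) T k
      ∎

  lincomb-δ : ∀ (cs : Fin (suc d) → Carrier) → lincomb cs δ ≈v cs
  lincomb-δ cs k = trans (lincomb-pointwise cs δ k) (∑-δ cs k)

  span-resp : ∀ {n} {B : Fin n → Vector} {v w} → v ≈v w → InSpan B w → InSpan B v
  span-resp v≈w (cs , w≈) = cs , λ k → trans (v≈w k) (w≈ k)

  span-0 : ∀ {n} (B : Fin n → Vector) → InSpan B 0v
  span-0 B = (λ _ → 0#) , λ k → sym (lincomb-zero B (λ _ → refl) k)

  span-+ : ∀ {n} {B : Fin n → Vector} {v w} → InSpan B v → InSpan B w → InSpan B (v +v w)
  span-+ {B = B} (cs , v≈) (ds , w≈) =
    (λ i → cs i + ds i) , λ k → trans (+-cong (v≈ k) (w≈ k)) (sym (lincomb-+ cs ds B k))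

  span-· : ∀ {n} {B : Fin n → Vector} a {v} → InSpan B v → InSpan B (a ·v v)
  span-· {B = B} a (cs , v≈) = (λ i → a * cs i) , λ k → trans (*-congˡ (v≈ k)) (sym (lincomb-· a cs B k))

  span-·⁻¹ : ∀ {n} {B : Fin n → Vector} {a v} → ¬ a ≈ 0# → InSpan B (a ·v v) → InSpan B v
  span-·⁻¹ a≉0 av∈B = span-resp (λ k → sym (⁻¹-cancelˡ a≉0 _)) (span-· _ av∈B)

  span-lincomb : ∀ {n m} {B : Fin n → Vector} (cs : Fin m → Carrier) (us : Fin m → Vector) →
                 (∀ i → InSpan B (us i)) → InSpan B (lincomb cs us)
  span-lincomb {m = zero}  {B} cs us us∈B = span-0 B
  span-lincomb {m = suc m}     cs us us∈B =
    span-+ (span-· (cs zero) (us∈B zero)) (span-lincomb (cs ∘ suc) (us ∘ suc) (us∈B ∘ suc))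

  span-member : ∀ {n} (B : Fin n → Vector) i → InSpan B (B i)
  span-member B i = (λ j → δ j i) , λ k → sym (begin
    lincomb (λ j → δ j i) B k   ≈⟨ lincomb-pointwise _ B k ⟩
    sum (λ j → δ j i * B j k)   ≈⟨ sum-cong-≋ (λ j → *-comm (δ j i) (B j k)) ⟩
    sum (λ j → B j k * δ j i)   ≈⟨ ∑-δ (λ j → B j k) i ⟩
    B i k                       ∎)

  dependent-in-smaller-span : ∀ {n m} → n < m → (r : Fin n → Vector) (u : Fin m → Vector) →
                              (∀ i → InSpan r (u i)) → ∃ λ cs → NonTrivial cs × lincomb cs u ≈v 0v
  dependent-in-smaller-span {n} {m} n<m r u u∈r =
    let (cs , nonTrivial , solves) = homogeneous-nonTrivial n<m Mᵀ
    in cs , nonTrivial , vanishes cs solves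
    where
    M : Fin m → Fin n → Carrier
    M i = proj₁ (u∈r i)

    Mᵀ : Fin n → Fin m → Carrier
    Mᵀ j i = M i j

    vanishes : ∀ cs → Solves Mᵀ cs → lincomb cs u ≈v 0v
    vanishes cs solves k = begin
      lincomb cs u k
        ≈⟨ lincomb-pointwise cs u k ⟩
      sum (λ i → cs i * u i k)
        ≈⟨ sum-cong-≋ (λ i → *-congˡ (trans (proj₂ (u∈r i) k) (lincomb-pointwise (M i) r k))) ⟩
      sum (λ i → cs i * sum (λ j → M i j * r j k))
        ≈⟨ sum-cong-≋ (λ i → *-distribˡ-sum (cs i) (λ j → M i j * r j k)) ⟩
      sum (λ i → sum (λ j → cs i * (M i j * r j k)))
        ≈⟨ ∑-comm (λ i j → cs i * (M i j * r j k)) ⟩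
      sum (λ j → sum (λ i → cs i * (M i j * r j k)))
        ≈⟨ sum-cong-≋ (λ j → sum-cong-≋ (λ i → solve 3 (λ x y z → x :* (y :* z) := z :* (y :* x)) refl (cs i) (M i j) (r j k))) ⟩
      sum (λ j → sum (λ i → r j k * (M i j * cs i)))
        ≈⟨ sum-cong-≋ (λ j → *-distribˡ-sum (r j k) (λ i → M i j * cs i)) ⟨
      sum (λ j → r j k * (Mᵀ j ⋅ cs))
        ≈⟨ sum-cong-≋ (λ j → trans (*-congˡ (solves j)) (zeroʳ (r j k))) ⟩
      sum {n} (λ _ → 0#)
        ≈⟨ sum-replicate-zero n ⟩
      0# ∎

  spans-meet : ∀ {n a b} (r : Fin n → Vector) (S : Fin a → Vector) (T : Fin b → Vector) →
               Independent S → Independent T → (∀ i → InSpan r (S i)) → (∀ j → InSpan r (T j)) →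
               n < a ℕ.+ b → ∃ λ v → Nonzero v × InSpan S v × InSpan T v
  spans-meet {a = a} r S T S-indep T-indep S∈r T∈r n<a+b =
    let (cs , nonTrivial , relation) = dependent-in-smaller-span n<a+b r (S ++ T) (++⁺ (InSpan r) S∈r T∈r)
    in common cs nonTrivial relation
    where
    common : ∀ cs → NonTrivial cs → lincomb cs (S ++ T) ≈v 0v → ∃ λ v → Nonzero v × InSpan S v × InSpan T v
    common cs (i , csᵢ≉0) relation = sS , sS≉0 , (take a cs , λ _ → refl) , sS∈T
      where
      sS sT : Vector
      sS = lincomb (take a cs) S
      sT = lincomb (drop a cs) T
      sS+sT≈0 : ∀ k → sS k + sT k ≈ 0#
      sS+sT≈0 k = trans (sym (lincomb-++ cs S T k)) (relation k)
      sS∈T : InSpan T sS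
      sS∈T = (λ j → - 1# * drop a cs j) , λ k → begin
        sS k                   ≈⟨ inverseˡ-unique _ _ (sS+sT≈0 k) ⟩
        - sT k                 ≈⟨ -1*x≈-x (sT k) ⟨
        - 1# * sT k            ≈⟨ lincomb-· (- 1#) (drop a cs) T k ⟨
        lincomb (λ j → - 1# * drop a cs j) T k ∎
      sS≉0 : Nonzero sS
      sS≉0 sS≈0 = csᵢ≉0 (≡.subst (_≈ 0#) (take-++-drop a cs i) (++⁺ (_≈ 0#) take≈0 drop≈0 i))
        where
        take≈0 : ∀ j → take a cs j ≈ 0#
        take≈0 = S-indep (take a cs) sS≈0
        drop≈0 : ∀ j → drop a cs j ≈ 0#
        drop≈0 = T-indep (drop a cs) λ k → trans (sym (+-identityˡ (sT k))) (trans (+-congʳ (sym (sS≈0 k))) (sS+sT≈0 k))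

  cramer₀ : ∀ (L : Fin 2 → Vector) a b →
            ((b (suc zero) ·v lincomb a L) +v ((- a (suc zero)) ·v lincomb b L)) ≈v (det a b ·v L zero)
  cramer₀ L a b k = begin
    b₁ * (a₀ * X + (a₁ * Y + 0#)) + (- a₁) * (b₀ * X + (b₁ * Y + 0#))
      ≈⟨ solve 7 (λ a₀ a₁ b₀ b₁ m X Y → b₁ :* (a₀ :* X :+ (a₁ :* Y :+ con 0)) :+ m :* (b₀ :* X :+ (b₁ :* Y :+ con 0))
                                      := (a₀ :* b₁ :+ m :* b₀) :* X :+ (a₁ :* (b₁ :* Y) :+ m :* (b₁ :* Y)))
               refl a₀ a₁ b₀ b₁ (- a₁) X Y ⟩
    (a₀ * b₁ + (- a₁) * b₀) * X + (a₁ * (b₁ * Y) + (- a₁) * (b₁ * Y))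
      ≈⟨ +-cong (*-congʳ (+-congˡ (sym (-‿distribˡ-* a₁ b₀)))) (-‿cancel a₁ (b₁ * Y)) ⟩
    det a b * X + 0#
      ≈⟨ +-identityʳ _ ⟩
    det a b * X ∎
    where
    a₀ a₁ b₀ b₁ X Y : Carrier
    a₀ = a zero; a₁ = a (suc zero); b₀ = b zero; b₁ = b (suc zero)
    X = L zero k; Y = L (suc zero) k

  cramer₁ : ∀ (L : Fin 2 → Vector) a b →
            ((a zero ·v lincomb b L) +v ((- b zero) ·v lincomb a L)) ≈v (det a b ·v L (suc zero))
  cramer₁ L a b k = begin
    a₀ * (b₀ * X + (b₁ * Y + 0#)) + (- b₀) * (a₀ * X + (a₁ * Y + 0#))
      ≈⟨ solve 7 (λ a₀ a₁ b₀ b₁ m X Y → a₀ :* (b₀ :* X :+ (b₁ :* Y :+ con 0)) :+ m :* (a₀ :* X :+ (a₁ :* Y :+ con 0))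
                                      := (b₀ :* (a₀ :* X) :+ m :* (a₀ :* X)) :+ (a₀ :* b₁ :+ m :* a₁) :* Y)
               refl a₀ a₁ b₀ b₁ (- b₀) X Y ⟩
    (b₀ * (a₀ * X) + (- b₀) * (a₀ * X)) + (a₀ * b₁ + (- b₀) * a₁) * Y
      ≈⟨ +-cong (-‿cancel b₀ (a₀ * X)) (*-congʳ (+-congˡ (trans (sym (-‿distribˡ-* b₀ a₁)) (-‿cong (*-comm b₀ a₁))))) ⟩
    0# + det a b * Y
      ≈⟨ +-identityˡ _ ⟩
    det a b * Y ∎
    where
    a₀ a₁ b₀ b₁ X Y : Carrier
    a₀ = a zero; a₁ = a (suc zero); b₀ = b zero; b₁ = b (suc zero)
    X = L zero k; Y = L (suc zero) k

  line-span-meet-unique : ∀ {n} (L : Fin 2 → Vector) (R : Fin n → Vector) → ¬ (∀ i → InSpan R (L i)) →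
                          ∀ {v w} → Nonzero v → InSpan L v → InSpan L w → InSpan R v → InSpan R w → SamePoint w v
  line-span-meet-unique L R L⊈R {v} {w} v≉0 (a , v≈) (b , w≈) v∈R w∈R with det a b ≟ 0#
  ... | no det≉0 = contradiction L⊆R L⊈R
    where
    a∈R : InSpan R (lincomb a L)
    a∈R = span-resp (λ k → sym (v≈ k)) v∈R
    b∈R : InSpan R (lincomb b L)
    b∈R = span-resp (λ k → sym (w≈ k)) w∈R
    L⊆R : ∀ i → InSpan R (L i)
    L⊆R zero       = span-·⁻¹ det≉0 (span-resp (λ k → sym (cramer₀ L a b k)) (span-+ (span-· _ a∈R) (span-· _ b∈R)))
    L⊆R (suc zero) = span-·⁻¹ det≉0 (span-resp (λ k → sym (cramer₁ L a b k)) (span-+ (span-· _ b∈R) (span-· _ a∈R)))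
  ... | yes det≈0 with zero-or-nonTrivial a
  ...   | inj₁ a≈0 = contradiction (λ k → trans (v≈ k) (lincomb-zero L a≈0 k)) v≉0
  ...   | inj₂ (p , aₚ≉0) = s , λ k → begin
    w k                            ≈⟨ w≈ k ⟩
    lincomb b L k                  ≈⟨ lincomb-cong L (det≈0⇒proportional {a} {b} det≈0 p aₚ≉0) k ⟩
    lincomb (λ i → s * a i) L k    ≈⟨ lincomb-· s a L k ⟩
    s * lincomb a L k              ≈⟨ *-congˡ (v≈ k) ⟨
    s * v k                        ∎
    where
    s : Carrier
    s = (a p ⁻¹) aₚ≉0 * b p

  ⊆-from-basis : (S T : Subspace) → (∀ i → basis S i ∈ T) → S ⊆ T
  ⊆-from-basis S T basis∈T v (cs , v≈) =
    span-resp {B = basis T} v≈ (span-lincomb {B = basis T} cs (basis S) basis∈T)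

  wholeSpace : Subspace
  wholeSpace = record
    { dim   = d
    ; basis = δ
    ; indep = λ cs cs≈0 k → trans (sym (lincomb-δ cs k)) (cs≈0 k)
    }

  ⊆-wholeSpace : (S : Subspace) → S ⊆ wholeSpace
  ⊆-wholeSpace S v _ = v , λ k → sym (lincomb-δ v k)

  subspaces-meet : (S T U : Subspace) → S ⊆ U → T ⊆ U → dim U ≤ dim S ℕ.+ dim T →
                   ∃ λ v → Nonzero v × v ∈ S × v ∈ T
  subspaces-meet S T U S⊆U T⊆U dimU≤ =
    spans-meet (basis U) (basis S) (basis T) (indep S) (indep T)
      (λ i → S⊆U _ (span-member (basis S) i)) (λ j → T⊆U _ (span-member (basis T) j))
      (s≤s (≡.subst (suc (dim U) ≤_) (≡.sym (+-suc (dim S) (dim T))) (s≤s dimU≤)))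

  contains-all⇒d≤dim : (U : Subspace) → (∀ w → w ∈ U) → d ≤ dim U
  contains-all⇒d≤dim U contains-all = ≮⇒≥ λ dimU<d →
    let (cs , (k , csₖ≉0) , relation) = dependent-in-smaller-span (s≤s dimU<d) (basis U) δ (contains-all ∘ δ)
    in csₖ≉0 (trans (sym (lincomb-δ cs k)) (relation k))

  opposite⇒⊈ : (S T R : Subspace) → NoCommonPoint S T ⊎ SpanAll S T → T ⊆ R →
               dim R ≤ dim S ℕ.+ dim T → dim R < d → ¬ S ⊆ R
  opposite⇒⊈ S T R (inj₁ disjoint) T⊆R dimR≤ _ S⊆R =
    let (v , v≉0 , v∈S , v∈T) = subspaces-meet S T R S⊆R T⊆R dimR≤
    in v≉0 (disjoint v v∈S v∈T)
  opposite⇒⊈ S T R (inj₂ spanning) T⊆R _ dimR<d S⊆R = <⇒≱ dimR<d (contains-all⇒d≤dim R contains-all)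
    where
    contains-all : ∀ w → w ∈ R
    contains-all w =
      let (u , v , u∈S , v∈T , w≈u+v) = spanning w
      in span-resp {B = basis R} w≈u+v (span-+ {B = basis R} (S⊆R u u∈S) (T⊆R v v∈T))

  line-meet-unique : (L R : Subspace) → dim L ≡ 1 → ¬ L ⊆ R →
                     ∀ {v w} → Nonzero v → v ∈ L → w ∈ L → v ∈ R → w ∈ R → SamePoint w v
  line-meet-unique L R ≡.refl L⊈R =
    line-span-meet-unique (basis L) (basis R) (λ basis∈R → L⊈R (⊆-from-basis L R basis∈R))

lemma2p3 : ∀ {c ℓ : Level} {q : ℕ} (F : FiniteField c ℓ q) (d : ℕ) → 3 ≤ d →
    let open PG F d in
    (C D : Chamber) → FOpposite C D →
    (one : Fin d) → toℕ one ≡ 1 →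
    (hyp : Fin d) → toℕ hyp ≡ d ∸ 1 →
    -- R = S_{d-1} of D contains exactly one point of the line S_1 of C
    ∃ λ v → Nonzero v × v ∈ sub C one × v ∈ sub D hyp ×
      (∀ w → Nonzero w → w ∈ sub C one → w ∈ sub D hyp → SamePoint w v)
lemma2p3 F d@(suc (suc (suc e))) (s≤s (s≤s (s≤s _))) C D opposite one one≡1 hyp hyp≡d-1 =
  let (v , v≉0 , v∈L , v∈R) = subspaces-meet L R wholeSpace (⊆-wholeSpace L) (⊆-wholeSpace R) d≤L+R
  in v , v≉0 , v∈L , v∈R , λ w _ w∈L w∈R → line-meet-unique L R dimL≡1 L⊈R v≉0 v∈L w∈L v∈R w∈R
  where
  open PG F d
  open Subspaces F d

  d-2<d : d ∸ 2 < d
  d-2<d = s≤s (s≤s (n≤1+n e))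

  t : Fin d
  t = fromℕ< d-2<d

  t≡d-2 : toℕ t ≡ d ∸ 2
  t≡d-2 = toℕ-fromℕ< d-2<d

  L R T : Subspace
  L = sub C one
  R = sub D hyp
  T = sub D t

  dimL≡1 : dim L ≡ 1
  dimL≡1 = ≡.trans (sub-dim C one) one≡1

  d≤L+R : d ≤ dim L ℕ.+ dim R
  d≤L+R rewrite dimL≡1 | sub-dim D hyp | hyp≡d-1 = ≤-refl

  L⊈R : ¬ L ⊆ R
  L⊈R = opposite⇒⊈ L T R (opposite one t one∈coflag t∈coflag) T⊆R R≤L+T R<d
    where
    one∈coflag : InCoflag one
    one∈coflag rewrite one≡1 = s≤s z≤n , s≤s z≤n
    t∈coflag : InCoflag t
    t∈coflag rewrite t≡d-2 = s≤s z≤n , ≤-refl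
    T⊆R : T ⊆ R
    T⊆R = sub-inc D t hyp (≡.trans (≡.cong suc t≡d-2) (≡.sym hyp≡d-1))
    R≤L+T : dim R ≤ dim L ℕ.+ dim T
    R≤L+T rewrite dimL≡1 | sub-dim D hyp | hyp≡d-1 | sub-dim D t | t≡d-2 = ≤-refl
    R<d : dim R < d
    R<d rewrite sub-dim D hyp | hyp≡d-1 = ≤-refl
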